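{- Let $S$ be a finite nonempty set of integers with $|S+S|-|S-S|\ge 10|S|$. If $a_1<a_2<a_3<a_4$ are integers with $a_1>\max S$, then $S\cup\{a_1,a_2,a_3,a_4\}$ is MSTD. Similarly, if $b_1<b_2<b_3<b_4$ are integers with $b_4<\min S$, then $S\cup\{b_1,b_2,b_3,b_4\}$ is MSTD.
   Context: For a set $A$ of integers, $A+A=\{x+y:x,y\in A\}$ and $A-A=\{x-y:x,y\in A\}$. A finite set $A$ is MSTD if $|A+A|>|A-A|$. -}

module Defs where

open import Data.Nat as ℕ using (ℕ)
open import Data.Integer as ℤ using (ℤ; _+_; _-_; _≟_)
open import Data.List using (List; length; deduplicate; concatMap; map)

-- A finite set of integers is represented by a list (the set of its entries;
-- repetitions and order are irrelevant).

card : List ℤ → ℕ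
card A = length (deduplicate _≟_ A)

sumset : List ℤ → List ℤ
sumset A = concatMap (λ x → map (λ y → x + y) A) A

diffset : List ℤ → List ℤ
diffset A = concatMap (λ x → map (λ y → x - y) A) A

MSTD : List ℤ → Set
MSTD A = card (diffset A) ℕ.< card (sumset A)

-- Write A = S ∪ T with T = {t₁ < t₂ < t₃ < t₄} lying entirely on one side of S,
-- c = |S|, d = |S - S|, s = |S + S|, and assume d + 10c ≤ s.
--
-- Every element of A - A is either in S - S or of the form
--    t - x or x - t with t ∈ T, so |A - A| ≤ d + 4(c + 4) + 4c = d + 8c + 16.
--  * Sums.  S + S and T + T are contained in A + A and, T being on one side
--    of S, they are disjoint; the seven sums t₁+t₁ < t₁+t₂ < t₂+t₂ < t₂+t₃ <
--    t₃+t₃ < t₃+t₄ < t₄+t₄ are distinct, hence |A + A| ≥ s + 7 ≥ d + 10c + 7.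
--  * Size of S.  Since 10c ≤ s ≤ c² and c ≥ 1, we get c ≥ 10, so that
--    8c + 16 < 10c + 7 and therefore |A - A| < |A + A|.
module Submission where

open import Defs
open import Data.Nat as ℕ using (ℕ)
open import Data.Integer as ℤ using (ℤ)
open import Data.List using (List; []; _∷_; _++_)
open import Data.List.Relation.Unary.All using (All)
open import Data.Product using (_×_)
open import Relation.Binary.PropositionalEquality using (_≢_)

open import Data.Nat using (z≤n; s≤s)
import Data.Nat.Properties as ℕP
open import Data.Nat.Tactic.RingSolver using (solve-∀)
import Data.Integer.Properties as ℤP
open import Data.List using (length; filter; map; concatMap; cartesianProductWith; deduplicate)
import Data.List.Properties as ListP
open import Data.List.Membership.Propositional using (_∈_)
open import Data.List.Membership.Propositional.Properties
  using (∈-filter⁺; ∈-deduplicate⁺; ∈-deduplicate⁻; ∈-++⁺ˡ; ∈-++⁺ʳ; ∈-++⁻;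
         ∈-cartesianProductWith⁺; ∈-cartesianProductWith⁻)
open import Data.List.Relation.Binary.Subset.Propositional using (_⊆_)
open import Data.List.Relation.Binary.Disjoint.Propositional using (Disjoint)
import Data.List.Relation.Binary.Disjoint.Setoid.Properties as DisjointP
open import Data.List.Relation.Unary.Any using (here; there)
import Data.List.Relation.Unary.Any as Any
import Data.List.Relation.Unary.All as All
import Data.List.Relation.Unary.AllPairs as AllPairs
open import Data.List.Relation.Unary.Unique.Propositional using (Unique; []; _∷_)
import Data.List.Relation.Unary.Unique.Propositional.Properties as UniqueP
open import Data.List.Relation.Unary.Unique.DecPropositional.Properties using (deduplicate-!)
open import Data.List.Relation.Unary.Linked using (Linked; [-]; _∷_)
open import Data.List.Relation.Unary.Linked.Properties using (Linked⇒AllPairs)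
open import Data.Product using (_,_; ∃; proj₁; proj₂)
open import Data.Empty using (⊥-elim)
open import Data.Sum using (inj₁; inj₂)
open import Relation.Nullary using (¬?)
open import Relation.Binary.PropositionalEquality
  using (_≡_; refl; sym; trans; cong; cong₂; subst; setoid)

-- Pigeonhole: a duplicate-free list whose entries all occur in ys is no
-- longer than ys.  Remove every copy of the head from ys and recurse.
unique-length-≤ : {xs ys : List ℤ} → Unique xs → xs ⊆ ys → length xs ℕ.≤ length ys
unique-length-≤ {[]} _ _ = z≤n
unique-length-≤ {x ∷ xs} {ys} (x∉xs ∷ xs!) xs⊆ys =
  ℕP.≤-trans (s≤s (unique-length-≤ xs! xs⊆rest))
             (ListP.filter-notAll ≢x? ys (Any.map (λ { refl x≢x → x≢x refl }) (xs⊆ys (here refl))))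
  where
  ≢x? = λ y → ¬? (x ℤ.≟ y)
  xs⊆rest : xs ⊆ filter ≢x? ys
  xs⊆rest y∈xs = ∈-filter⁺ ≢x? (xs⊆ys (there y∈xs)) (All.lookup x∉xs y∈xs)

unique-length-≤-card : {xs B : List ℤ} → Unique xs → xs ⊆ B → length xs ℕ.≤ card B
unique-length-≤-card xs! xs⊆B = unique-length-≤ xs! (λ p → ∈-deduplicate⁺ ℤ._≟_ (xs⊆B p))

card-nonempty : (S : List ℤ) → S ≢ [] → 1 ℕ.≤ card S
card-nonempty [] S≢[] = ⊥-elim (S≢[] refl)
card-nonempty (x ∷ xs) _ = unique-length-≤-card {x ∷ []} {x ∷ xs} (All.[] ∷ []) λ { (here refl) → here refl }

card-⊆-++ : (A B D : List ℤ) → A ⊆ B ++ D → card A ℕ.≤ card B ℕ.+ length D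
card-⊆-++ A B D A⊆B++D =
  ℕP.≤-trans (unique-length-≤ (deduplicate-! ℤ._≟_ A) ddA⊆ddB++D)
             (ℕP.≤-reflexive (ListP.length-++ (deduplicate ℤ._≟_ B)))
  where
  ddA⊆ddB++D : deduplicate ℤ._≟_ A ⊆ deduplicate ℤ._≟_ B ++ D
  ddA⊆ddB++D p with ∈-++⁻ B (A⊆B++D (∈-deduplicate⁻ ℤ._≟_ A p))
  ... | inj₁ q = ∈-++⁺ˡ (∈-deduplicate⁺ ℤ._≟_ q)
  ... | inj₂ q = ∈-++⁺ʳ (deduplicate ℤ._≟_ B) q

card-disjoint-≤ : {X Y Z : List ℤ} → Disjoint X Y → X ⊆ Z → Y ⊆ Z →
                  card X ℕ.+ card Y ℕ.≤ card Z
card-disjoint-≤ {X} {Y} {Z} X#Y X⊆Z Y⊆Z =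
  subst (ℕ._≤ card Z) (ListP.length-++ (deduplicate ℤ._≟_ X))
        (unique-length-≤-card ddX++ddY! ddX++ddY⊆Z)
  where
  ddX++ddY! : Unique (deduplicate ℤ._≟_ X ++ deduplicate ℤ._≟_ Y)
  ddX++ddY! = UniqueP.++⁺ (deduplicate-! ℤ._≟_ X) (deduplicate-! ℤ._≟_ Y)
    (λ { (p , q) → X#Y (∈-deduplicate⁻ ℤ._≟_ X p , ∈-deduplicate⁻ ℤ._≟_ Y q) })
  ddX++ddY⊆Z : deduplicate ℤ._≟_ X ++ deduplicate ℤ._≟_ Y ⊆ Z
  ddX++ddY⊆Z p with ∈-++⁻ (deduplicate ℤ._≟_ X) p
  ... | inj₁ q = X⊆Z (∈-deduplicate⁻ ℤ._≟_ X q)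
  ... | inj₂ q = Y⊆Z (∈-deduplicate⁻ ℤ._≟_ Y q)

-- The list of all values f x y with x, y ∈ A; by definition
-- sumset A = table _+_ A and diffset A = table _-_ A.
table : (ℤ → ℤ → ℤ) → List ℤ → List ℤ
table f A = concatMap (λ x → map (f x) A) A

-- A table is the cartesian product of A with itself under f, which gives
-- access to the library's membership lemmas; its length is |xs|·|ys|.
table≡cartesianProduct : (f : ℤ → ℤ → ℤ) (xs ys : List ℤ) →
  concatMap (λ x → map (f x) ys) xs ≡ cartesianProductWith f xs ys
table≡cartesianProduct f [] ys = refl
table≡cartesianProduct f (x ∷ xs) ys = cong (map (f x) ys ++_) (table≡cartesianProduct f xs ys)

length-cartesianProduct : (f : ℤ → ℤ → ℤ) (xs ys : List ℤ) →
  length (cartesianProductWith f xs ys) ≡ length xs ℕ.* length ys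
length-cartesianProduct f [] ys = refl
length-cartesianProduct f (x ∷ xs) ys =
  trans (ListP.length-++ (map (f x) ys))
        (cong₂ ℕ._+_ (ListP.length-map (f x) ys) (length-cartesianProduct f xs ys))

∈-table⁺ : (f : ℤ → ℤ → ℤ) {A : List ℤ} {a b : ℤ} → a ∈ A → b ∈ A → f a b ∈ table f A
∈-table⁺ f {A} a∈A b∈A =
  subst (_ ∈_) (sym (table≡cartesianProduct f A A)) (∈-cartesianProductWith⁺ f a∈A b∈A)

∈-table⁻ : (f : ℤ → ℤ → ℤ) {A : List ℤ} {z : ℤ} → z ∈ table f A →
           ∃ λ a → ∃ λ b → a ∈ A × b ∈ A × z ≡ f a b
∈-table⁻ f {A} z∈ = ∈-cartesianProductWith⁻ f A A (subst (_ ∈_) (table≡cartesianProduct f A A) z∈)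

table-mono : (f : ℤ → ℤ → ℤ) {A B : List ℤ} → A ⊆ B → table f A ⊆ table f B
table-mono f A⊆B z∈ with ∈-table⁻ f z∈
... | a , b , a∈A , b∈A , refl = ∈-table⁺ f (A⊆B a∈A) (A⊆B b∈A)

table-dedup : (f : ℤ → ℤ → ℤ) (A : List ℤ) → table f A ⊆ table f (deduplicate ℤ._≟_ A)
table-dedup f A = table-mono f (∈-deduplicate⁺ ℤ._≟_ {xs = A})

-- |A + A| ≤ |A|², since A + A lies in the table of the |A| distinct entries
-- of A, which has |A|² entries.
card-sumset-≤-square : (S : List ℤ) → card (sumset S) ℕ.≤ card S ℕ.* card S
card-sumset-≤-square S =
  ℕP.≤-trans (card-⊆-++ (sumset S) [] (table ℤ._+_ (deduplicate ℤ._≟_ S)) (table-dedup ℤ._+_ S))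
             (ℕP.≤-reflexive (trans (cong length (table≡cartesianProduct ℤ._+_ S′ S′))
                                    (length-cartesianProduct ℤ._+_ S′ S′)))
  where S′ = deduplicate ℤ._≟_ S

-- Adding k = |T| elements creates at most k(|S| + k) + |S|k new differences:
-- the t - x with t ∈ T, x ∈ S ∪ T and the x - t with x ∈ S, t ∈ T.
card-diffset-++ : (S T : List ℤ) →
  card (diffset (S ++ T)) ℕ.≤ card (diffset S) ℕ.+ (length T ℕ.* (card S ℕ.+ length T) ℕ.+ card S ℕ.* length T)
card-diffset-++ S T =
  subst (λ m → card (diffset (S ++ T)) ℕ.≤ card (diffset S) ℕ.+ m) length-new
        (card-⊆-++ (diffset (S ++ T)) (diffset S) new diffset⊆)
  where
  S′ = deduplicate ℤ._≟_ S
  fromT = cartesianProductWith ℤ._-_ T (S′ ++ T)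
  intoT = cartesianProductWith ℤ._-_ S′ T
  new = fromT ++ intoT
  length-new : length new ≡ length T ℕ.* (card S ℕ.+ length T) ℕ.+ card S ℕ.* length T
  length-new = trans (ListP.length-++ fromT)
    (cong₂ ℕ._+_ (trans (length-cartesianProduct ℤ._-_ T (S′ ++ T)) (cong (length T ℕ.*_) (ListP.length-++ S′)))
                 (length-cartesianProduct ℤ._-_ S′ T))
  diffset⊆ : diffset (S ++ T) ⊆ diffset S ++ new
  diffset⊆ z∈ with ∈-table⁻ ℤ._-_ z∈
  ... | a , b , a∈ , b∈ , refl with ∈-++⁻ S a∈ | ∈-++⁻ S b∈
  ... | inj₁ a∈S | inj₁ b∈S = ∈-++⁺ˡ (∈-table⁺ ℤ._-_ a∈S b∈S)
  ... | inj₁ a∈S | inj₂ b∈T = ∈-++⁺ʳ (diffset S) (∈-++⁺ʳ fromT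
                                 (∈-cartesianProductWith⁺ ℤ._-_ (∈-deduplicate⁺ ℤ._≟_ a∈S) b∈T))
  ... | inj₂ a∈T | inj₁ b∈S = ∈-++⁺ʳ (diffset S) (∈-++⁺ˡ
                                 (∈-cartesianProductWith⁺ ℤ._-_ a∈T (∈-++⁺ˡ (∈-deduplicate⁺ ℤ._≟_ b∈S))))
  ... | inj₂ a∈T | inj₂ b∈T = ∈-++⁺ʳ (diffset S) (∈-++⁺ˡ
                                 (∈-cartesianProductWith⁺ ℤ._-_ a∈T (∈-++⁺ʳ S′ b∈T)))

card-sumset-++ : (S T : List ℤ) → Disjoint (sumset S) (sumset T) →
                 card (sumset S) ℕ.+ card (sumset T) ℕ.≤ card (sumset (S ++ T))
card-sumset-++ S T S+S#T+T =
  card-disjoint-≤ S+S#T+T (table-mono ℤ._+_ {S} (∈-++⁺ˡ)) (table-mono ℤ._+_ {T} (∈-++⁺ʳ S))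

separated-sumsets-disjoint : {X Y : List ℤ} → (∀ {x y} → x ∈ X → y ∈ Y → x ℤ.< y) →
                             Disjoint (sumset X) (sumset Y)
separated-sumsets-disjoint X<Y (u∈X+X , u∈Y+Y)
  with ∈-table⁻ ℤ._+_ u∈X+X | ∈-table⁻ ℤ._+_ u∈Y+Y
... | x , x′ , x∈ , x′∈ , refl | y , y′ , y∈ , y′∈ , x+x′≡y+y′ =
  ℤP.<-irrefl x+x′≡y+y′ (ℤP.+-mono-< (X<Y x∈ y∈) (X<Y x′∈ y′∈))

seven-sums : {t₁ t₂ t₃ t₄ : ℤ} → t₁ ℤ.< t₂ → t₂ ℤ.< t₃ → t₃ ℤ.< t₄ →
             7 ℕ.≤ card (sumset (t₁ ∷ t₂ ∷ t₃ ∷ t₄ ∷ []))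
seven-sums {t₁} {t₂} {t₃} {t₄} t₁<t₂ t₂<t₃ t₃<t₄ = unique-length-≤-card chain! chain⊆
  where
  T = t₁ ∷ t₂ ∷ t₃ ∷ t₄ ∷ []
  chain : List ℤ
  chain = t₁ ℤ.+ t₁ ∷ t₁ ℤ.+ t₂ ∷ t₂ ℤ.+ t₂ ∷ t₂ ℤ.+ t₃ ∷ t₃ ℤ.+ t₃ ∷ t₃ ℤ.+ t₄ ∷ t₄ ℤ.+ t₄ ∷ []
  increasing : Linked ℤ._<_ chain
  increasing = ℤP.+-monoʳ-< t₁ t₁<t₂ ∷ ℤP.+-monoˡ-< t₂ t₁<t₂ ∷ ℤP.+-monoʳ-< t₂ t₂<t₃
             ∷ ℤP.+-monoˡ-< t₃ t₂<t₃ ∷ ℤP.+-monoʳ-< t₃ t₃<t₄ ∷ ℤP.+-monoˡ-< t₄ t₃<t₄ ∷ [-]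
  chain! : Unique chain
  chain! = AllPairs.map ℤP.<⇒≢ (Linked⇒AllPairs ℤP.<-trans increasing)
  t₁∈ : t₁ ∈ T
  t₁∈ = here refl
  t₂∈ : t₂ ∈ T
  t₂∈ = there (here refl)
  t₃∈ : t₃ ∈ T
  t₃∈ = there (there (here refl))
  t₄∈ : t₄ ∈ T
  t₄∈ = there (there (there (here refl)))
  chain⊆ : chain ⊆ sumset T
  chain⊆ (here refl) = ∈-table⁺ ℤ._+_ t₁∈ t₁∈
  chain⊆ (there (here refl)) = ∈-table⁺ ℤ._+_ t₁∈ t₂∈
  chain⊆ (there (there (here refl))) = ∈-table⁺ ℤ._+_ t₂∈ t₂∈
  chain⊆ (there (there (there (here refl)))) = ∈-table⁺ ℤ._+_ t₂∈ t₃∈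
  chain⊆ (there (there (there (there (here refl))))) = ∈-table⁺ ℤ._+_ t₃∈ t₃∈
  chain⊆ (there (there (there (there (there (here refl)))))) = ∈-table⁺ ℤ._+_ t₃∈ t₄∈
  chain⊆ (there (there (there (there (there (there (here refl))))))) = ∈-table⁺ ℤ._+_ t₄∈ t₄∈

quadruple-bounds : {t₁ t₂ t₃ t₄ t : ℤ} → t₁ ℤ.< t₂ → t₂ ℤ.< t₃ → t₃ ℤ.< t₄ →
                   t ∈ (t₁ ∷ t₂ ∷ t₃ ∷ t₄ ∷ []) → t₁ ℤ.≤ t × t ℤ.≤ t₄
quadruple-bounds t₁<t₂ t₂<t₃ t₃<t₄ (here refl) =
  ℤP.≤-refl , ℤP.<⇒≤ (ℤP.<-trans t₁<t₂ (ℤP.<-trans t₂<t₃ t₃<t₄))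
quadruple-bounds t₁<t₂ t₂<t₃ t₃<t₄ (there (here refl)) =
  ℤP.<⇒≤ t₁<t₂ , ℤP.<⇒≤ (ℤP.<-trans t₂<t₃ t₃<t₄)
quadruple-bounds t₁<t₂ t₂<t₃ t₃<t₄ (there (there (here refl))) =
  ℤP.<⇒≤ (ℤP.<-trans t₁<t₂ t₂<t₃) , ℤP.<⇒≤ t₃<t₄
quadruple-bounds t₁<t₂ t₂<t₃ t₃<t₄ (there (there (there (here refl)))) =
  ℤP.<⇒≤ (ℤP.<-trans t₁<t₂ (ℤP.<-trans t₂<t₃ t₃<t₄)) , ℤP.≤-refl

ten-≤-size : (c d s : ℕ) → 1 ℕ.≤ c → d ℕ.+ 10 ℕ.* c ℕ.≤ s → s ℕ.≤ c ℕ.* c → 10 ℕ.≤ c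
ten-≤-size c d s 1≤c surplus s≤c² =
  ℕP.*-cancelʳ-≤ 10 c c {{ℕ.>-nonZero 1≤c}} (ℕP.≤-trans (ℕP.m+n≤o⇒n≤o d surplus) s≤c²)

-- Four new points create fewer new differences (8c + 16) than the surplus
-- 10c + 7 guaranteed for the sums, as soon as c ≥ 10 (indeed c ≥ 5 suffices).
new-differences-< : (c : ℕ) → 10 ℕ.≤ c → 4 ℕ.* (c ℕ.+ 4) ℕ.+ c ℕ.* 4 ℕ.< 10 ℕ.* c ℕ.+ 7
new-differences-< c 10≤c with ℕP.m≤n⇒∃[o]m+o≡n 10≤c
... | k , refl = ℕP.≤-trans (ℕP.m≤m+n _ (2 ℕ.* k ℕ.+ 10)) (ℕP.≤-reflexive (identity k))
  where
  identity : (k : ℕ) → ℕ.suc (4 ℕ.* ((10 ℕ.+ k) ℕ.+ 4) ℕ.+ (10 ℕ.+ k) ℕ.* 4) ℕ.+ (2 ℕ.* k ℕ.+ 10)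
                       ≡ 10 ℕ.* (10 ℕ.+ k) ℕ.+ 7
  identity = solve-∀

extension-is-MSTD : (S : List ℤ) → S ≢ [] →
  card (diffset S) ℕ.+ 10 ℕ.* card S ℕ.≤ card (sumset S) →
  (t₁ t₂ t₃ t₄ : ℤ) → t₁ ℤ.< t₂ → t₂ ℤ.< t₃ → t₃ ℤ.< t₄ →
  Disjoint (sumset S) (sumset (t₁ ∷ t₂ ∷ t₃ ∷ t₄ ∷ [])) →
  MSTD (S ++ (t₁ ∷ t₂ ∷ t₃ ∷ t₄ ∷ []))
extension-is-MSTD S S≢[] surplus t₁ t₂ t₃ t₄ t₁<t₂ t₂<t₃ t₃<t₄ S+S#T+T = begin-strict
  card (diffset (S ++ T))   ≤⟨ card-diffset-++ S T ⟩
  d ℕ.+ (4 ℕ.* (c ℕ.+ 4) ℕ.+ c ℕ.* 4)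
                            <⟨ ℕP.+-monoʳ-< d (new-differences-< c 10≤c) ⟩
  d ℕ.+ (10 ℕ.* c ℕ.+ 7)    ≡⟨ sym (ℕP.+-assoc d (10 ℕ.* c) 7) ⟩
  d ℕ.+ 10 ℕ.* c ℕ.+ 7      ≤⟨ ℕP.+-mono-≤ surplus (seven-sums t₁<t₂ t₂<t₃ t₃<t₄) ⟩
  s ℕ.+ card (sumset T)     ≤⟨ card-sumset-++ S T S+S#T+T ⟩
  card (sumset (S ++ T))    ∎
  where
  open ℕP.≤-Reasoning
  T = t₁ ∷ t₂ ∷ t₃ ∷ t₄ ∷ []
  c = card S
  d = card (diffset S)
  s = card (sumset S)
  10≤c : 10 ℕ.≤ c
  10≤c = ten-≤-size c d s (card-nonempty S S≢[]) surplus (card-sumset-≤-square S)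

lemma3p1 : (S : List ℤ) → S ≢ [] →
    card (diffset S) ℕ.+ 10 ℕ.* card S ℕ.≤ card (sumset S) →
    ((a₁ a₂ a₃ a₄ : ℤ) → a₁ ℤ.< a₂ → a₂ ℤ.< a₃ → a₃ ℤ.< a₄ →
    All (ℤ._< a₁) S → MSTD (S ++ (a₁ ∷ a₂ ∷ a₃ ∷ a₄ ∷ [])))
    × ((b₁ b₂ b₃ b₄ : ℤ) → b₁ ℤ.< b₂ → b₂ ℤ.< b₃ → b₃ ℤ.< b₄ →
    All (b₄ ℤ.<_) S → MSTD (S ++ (b₁ ∷ b₂ ∷ b₃ ∷ b₄ ∷ [])))
lemma3p1 S S≢[] surplus = above , below
  where
  above : (a₁ a₂ a₃ a₄ : ℤ) → a₁ ℤ.< a₂ → a₂ ℤ.< a₃ → a₃ ℤ.< a₄ →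
          All (ℤ._< a₁) S → MSTD (S ++ (a₁ ∷ a₂ ∷ a₃ ∷ a₄ ∷ []))
  above a₁ a₂ a₃ a₄ a₁<a₂ a₂<a₃ a₃<a₄ S<a₁ =
    extension-is-MSTD S S≢[] surplus a₁ a₂ a₃ a₄ a₁<a₂ a₂<a₃ a₃<a₄
      (separated-sumsets-disjoint λ x∈S t∈T →
        ℤP.<-≤-trans (All.lookup S<a₁ x∈S) (proj₁ (quadruple-bounds a₁<a₂ a₂<a₃ a₃<a₄ t∈T)))
  below : (b₁ b₂ b₃ b₄ : ℤ) → b₁ ℤ.< b₂ → b₂ ℤ.< b₃ → b₃ ℤ.< b₄ →
          All (b₄ ℤ.<_) S → MSTD (S ++ (b₁ ∷ b₂ ∷ b₃ ∷ b₄ ∷ []))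
  below b₁ b₂ b₃ b₄ b₁<b₂ b₂<b₃ b₃<b₄ b₄<S =
    extension-is-MSTD S S≢[] surplus b₁ b₂ b₃ b₄ b₁<b₂ b₂<b₃ b₃<b₄
      (DisjointP.sym (setoid ℤ) (separated-sumsets-disjoint λ t∈T x∈S →
        ℤP.≤-<-trans (proj₂ (quadruple-bounds b₁<b₂ b₂<b₃ b₃<b₄ t∈T)) (All.lookup b₄<S x∈S)))
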